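{- There is an absolute constant $C>0$ such that for all positive integers $u\ge n$ and every $\varepsilon^{ - }\ge 0$ with $\varepsilon^{ - }\le 1-\frac1n$ and $n\varepsilon^{ - }$ an integer, \[ \log_2\frac{\binom{u}{n}}{\binom{u}{1+n\varepsilon^{ - }}}\ \ge\ \Big(1-\varepsilon^{ - }-\frac1n\Big)\log_2\binom{u}{n}-Cn . \] -}

module Defs where

{-# OPTIONS --safe #-}
module Submission where

-- With m = k + 1 ≤ n ≤ u, the bounds C(u,m) ≤ u^m / m! and C(u,n) ≥ (u/n)^n give
-- C(u,m)^n / C(u,n)^m ≤ (n^m / m!)^n, and n^m / m! ≤ C(n+m,m) ≤ 2^(n+m) ≤ 4^n.

open import Defs
open import Data.Nat using (ℕ; suc; _+_; _*_; _^_; _≤_; _<_)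
open import Data.Nat.Combinatorics using (_C_)
open import Data.Product using (∃; _×_)

open import Data.Nat.Base using (zero; _∸_; _!; z≤n; s≤s)
open import Data.Nat.Properties
open import Data.Nat.Combinatorics using (_P_; nCk≡nPk/k!; nCk+nC[k+1]≡[n+1]C[k+1])
open import Data.Nat.Combinatorics.Base using (_P′_)
open import Data.Nat.Combinatorics.Specification
  using (nPk≡n!/[n∸k]!; nP′k≡n!/[n∸k]!; nP′n≡n!; k!∣nP′k)
open import Data.Nat.DivMod using (_/_; m/n*n≡m)
open import Data.Product using (_,_)
open import Relation.Binary.PropositionalEquality

[m*n]^o≡m^o*n^o : ∀ m n o → (m * n) ^ o ≡ m ^ o * n ^ o
[m*n]^o≡m^o*n^o m n zero    = refl
[m*n]^o≡m^o*n^o m n (suc o) = begin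
  m * n * (m * n) ^ o      ≡⟨ cong (m * n *_) ([m*n]^o≡m^o*n^o m n o) ⟩
  m * n * (m ^ o * n ^ o)  ≡⟨ [m*n]*[o*p]≡[m*o]*[n*p] m n (m ^ o) (n ^ o) ⟩
  m * m ^ o * (n * n ^ o)  ∎
  where open ≡-Reasoning

[m^n]^o≡[m^o]^n : ∀ m n o → (m ^ n) ^ o ≡ (m ^ o) ^ n
[m^n]^o≡[m^o]^n m n o = begin
  (m ^ n) ^ o  ≡⟨ ^-*-assoc m n o ⟩
  m ^ (n * o)  ≡⟨ cong (m ^_) (*-comm n o) ⟩
  m ^ (o * n)  ≡⟨ ^-*-assoc m o n ⟨
  (m ^ o) ^ n  ∎
  where open ≡-Reasoning

nCk*k!≡nP′k : ∀ {n k} → k ≤ n → (n C k) * k ! ≡ n P′ k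
nCk*k!≡nP′k {n} {k} k≤n = begin
  (n C k) * k !         ≡⟨ cong (_* k !) (nCk≡nPk/k! k≤n) ⟩
  (n P k) / k ! * k !   ≡⟨ cong (λ p → p / k ! * k !) nPk≡nP′k ⟩
  (n P′ k) / k ! * k !  ≡⟨ m/n*n≡m (k!∣nP′k k≤n) ⟩
  n P′ k                ∎
  where
    instance _ = k !≢0
             _ = (n ∸ k) !≢0
    open ≡-Reasoning
    nPk≡nP′k : n P k ≡ n P′ k
    nPk≡nP′k = trans (nPk≡n!/[n∸k]! k≤n) (sym (nP′k≡n!/[n∸k]! k≤n))

nP′k≤n^k : ∀ n k → n P′ k ≤ n ^ k
nP′k≤n^k n zero    = ≤-refl
nP′k≤n^k n (suc k) = *-mono-≤ (m∸n≤m n k) (nP′k≤n^k n k)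

-- Each factor of n P′ k / m P′ k is (n ∸ j) / (m ∸ j) ≥ n / m.
m≤n⇒n^k*mP′k≤m^k*nP′k : ∀ {m n} → m ≤ n → ∀ k → n ^ k * (m P′ k) ≤ m ^ k * (n P′ k)
m≤n⇒n^k*mP′k≤m^k*nP′k m≤n zero    = ≤-refl
m≤n⇒n^k*mP′k≤m^k*nP′k {m} {n} m≤n (suc k) = begin
  n * n ^ k * ((m ∸ k) * (m P′ k))  ≡⟨ [m*n]*[o*p]≡[m*o]*[n*p] n (n ^ k) (m ∸ k) (m P′ k) ⟩
  n * (m ∸ k) * (n ^ k * (m P′ k))  ≤⟨ *-mono-≤ n[m∸k]≤m[n∸k] (m≤n⇒n^k*mP′k≤m^k*nP′k m≤n k) ⟩
  m * (n ∸ k) * (m ^ k * (n P′ k))  ≡⟨ [m*n]*[o*p]≡[m*o]*[n*p] m (n ∸ k) (m ^ k) (n P′ k) ⟩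
  m * m ^ k * ((n ∸ k) * (n P′ k))  ∎
  where
    open ≤-Reasoning
    n[m∸k]≤m[n∸k] : n * (m ∸ k) ≤ m * (n ∸ k)
    n[m∸k]≤m[n∸k] = begin
      n * (m ∸ k)    ≡⟨ *-distribˡ-∸ n m k ⟩
      n * m ∸ n * k  ≤⟨ ∸-monoʳ-≤ (n * m) (*-monoˡ-≤ k m≤n) ⟩
      n * m ∸ m * k  ≡⟨ cong (_∸ m * k) (*-comm n m) ⟩
      m * n ∸ m * k  ≡⟨ *-distribˡ-∸ m n k ⟨
      m * (n ∸ k)    ∎

m≤n⇒n^m≤nCm*m^m : ∀ {m n} → m ≤ n → n ^ m ≤ (n C m) * m ^ m
m≤n⇒n^m≤nCm*m^m {m} {n} m≤n = *-cancelʳ-≤ (n ^ m) ((n C m) * m ^ m) (m !) {{m !≢0}} (begin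
  n ^ m * m !              ≡⟨ cong (n ^ m *_) (nP′n≡n! m) ⟨
  n ^ m * (m P′ m)         ≤⟨ m≤n⇒n^k*mP′k≤m^k*nP′k m≤n m ⟩
  m ^ m * (n P′ m)         ≡⟨ cong (m ^ m *_) (nCk*k!≡nP′k m≤n) ⟨
  m ^ m * ((n C m) * m !)  ≡⟨ *-assoc (m ^ m) (n C m) (m !) ⟨
  m ^ m * (n C m) * m !    ≡⟨ cong (_* m !) (*-comm (m ^ m) (n C m)) ⟩
  (n C m) * m ^ m * m !    ∎)
  where open ≤-Reasoning

nCk≤2^n : ∀ n k → n C k ≤ 2 ^ n
nCk≤2^n n       zero    = m^n>0 2 n
nCk≤2^n zero    (suc k) = z≤n
nCk≤2^n (suc n) (suc k) = begin
  suc n C suc k          ≡⟨ nCk+nC[k+1]≡[n+1]C[k+1] n k ⟨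
  n C k + n C suc k      ≤⟨ +-mono-≤ (nCk≤2^n n k) (nCk≤2^n n (suc k)) ⟩
  2 ^ n + 2 ^ n          ≡⟨ cong (2 ^ n +_) (+-identityʳ (2 ^ n)) ⟨
  2 * 2 ^ n              ∎
  where open ≤-Reasoning

j≤k⇒m^j≤[m+k]P′j : ∀ {j k} m → j ≤ k → m ^ j ≤ (m + k) P′ j
j≤k⇒m^j≤[m+k]P′j {zero}  m _   = ≤-refl
j≤k⇒m^j≤[m+k]P′j {suc j} {k} m j<k = *-mono-≤ m≤m+k∸j (j≤k⇒m^j≤[m+k]P′j m (<⇒≤ j<k))
  where
    m≤m+k∸j : m ≤ m + k ∸ j
    m≤m+k∸j = begin
      m          ≡⟨ m+n∸n≡m m j ⟨
      m + j ∸ j  ≤⟨ ∸-monoˡ-≤ j (+-monoʳ-≤ m (<⇒≤ j<k)) ⟩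
      m + k ∸ j  ∎
      where open ≤-Reasoning

m≤n⇒n^m≤m!*2^[2n] : ∀ {m n} → m ≤ n → n ^ m ≤ m ! * 2 ^ (2 * n)
m≤n⇒n^m≤m!*2^[2n] {m} {n} m≤n = begin
  n ^ m                    ≤⟨ j≤k⇒m^j≤[m+k]P′j n (≤-refl {m}) ⟩
  (n + m) P′ m             ≡⟨ nCk*k!≡nP′k (m≤n+m m n) ⟨
  ((n + m) C m) * m !      ≤⟨ *-monoˡ-≤ (m !) (nCk≤2^n (n + m) m) ⟩
  2 ^ (n + m) * m !        ≤⟨ *-monoˡ-≤ (m !) (^-monoʳ-≤ 2 (+-monoʳ-≤ n (≤-trans m≤n (m≤m+n n 0)))) ⟩
  2 ^ (2 * n) * m !        ≡⟨ *-comm (2 ^ (2 * n)) (m !) ⟩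
  m ! * 2 ^ (2 * n)        ∎
  where open ≤-Reasoning

m≤n≤u⇒[uCm]^n≤[uCn]^m*2^[2n²] : ∀ {m n u} → m ≤ n → n ≤ u →
  (u C m) ^ n ≤ (u C n) ^ m * 2 ^ (2 * (n * n))
m≤n≤u⇒[uCm]^n≤[uCn]^m*2^[2n²] {m} {n} {u} m≤n n≤u =
  *-cancelʳ-≤ ((u C m) ^ n) ((u C n) ^ m * 2 ^ (2 * (n * n))) ((m !) ^ n) {{m^n≢0 (m !) n {{m !≢0}}}} (begin
    (u C m) ^ n * (m !) ^ n                        ≡⟨ [m*n]^o≡m^o*n^o (u C m) (m !) n ⟨
    ((u C m) * m !) ^ n                            ≡⟨ cong (_^ n) (nCk*k!≡nP′k (≤-trans m≤n n≤u)) ⟩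
    (u P′ m) ^ n                                   ≤⟨ ^-monoˡ-≤ n (nP′k≤n^k u m) ⟩
    (u ^ m) ^ n                                    ≡⟨ [m^n]^o≡[m^o]^n u m n ⟩
    (u ^ n) ^ m                                    ≤⟨ ^-monoˡ-≤ m (m≤n⇒n^m≤nCm*m^m n≤u) ⟩
    ((u C n) * n ^ n) ^ m                          ≡⟨ [m*n]^o≡m^o*n^o (u C n) (n ^ n) m ⟩
    (u C n) ^ m * (n ^ n) ^ m                      ≡⟨ cong ((u C n) ^ m *_) ([m^n]^o≡[m^o]^n n n m) ⟩
    (u C n) ^ m * (n ^ m) ^ n                      ≤⟨ *-monoʳ-≤ ((u C n) ^ m) (^-monoˡ-≤ n (m≤n⇒n^m≤m!*2^[2n] m≤n)) ⟩
    (u C n) ^ m * (m ! * 2 ^ (2 * n)) ^ n          ≡⟨ cong ((u C n) ^ m *_) [m!*2^[2n]]^n≡2^[2n²]*m!^n ⟩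
    (u C n) ^ m * (2 ^ (2 * (n * n)) * (m !) ^ n)  ≡⟨ *-assoc ((u C n) ^ m) (2 ^ (2 * (n * n))) ((m !) ^ n) ⟨
    (u C n) ^ m * 2 ^ (2 * (n * n)) * (m !) ^ n    ∎)
  where
    open ≤-Reasoning
    [m!*2^[2n]]^n≡2^[2n²]*m!^n : (m ! * 2 ^ (2 * n)) ^ n ≡ 2 ^ (2 * (n * n)) * (m !) ^ n
    [m!*2^[2n]]^n≡2^[2n²]*m!^n = begin-equality
      (m ! * 2 ^ (2 * n)) ^ n        ≡⟨ [m*n]^o≡m^o*n^o (m !) (2 ^ (2 * n)) n ⟩
      (m !) ^ n * (2 ^ (2 * n)) ^ n  ≡⟨ *-comm ((m !) ^ n) ((2 ^ (2 * n)) ^ n) ⟩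
      (2 ^ (2 * n)) ^ n * (m !) ^ n  ≡⟨ cong (_* (m !) ^ n) (^-*-assoc 2 (2 * n) n) ⟩
      2 ^ (2 * n * n) * (m !) ^ n    ≡⟨ cong (λ e → 2 ^ e * (m !) ^ n) (*-assoc 2 n n) ⟩
      2 ^ (2 * (n * n)) * (m !) ^ n  ∎

corollary12 : ∃ λ (c : ℕ) → (0 < c) ×
    ((u n k : ℕ) → 1 ≤ n → n ≤ u → k + 1 ≤ n →
      (u C (1 + k)) ^ n ≤ ((u C n) ^ (k + 1)) * 2 ^ (c * (n * n)))
corollary12 = 2 , s≤s z≤n , λ u n k _ n≤u k+1≤n →
  subst (λ m → (u C (1 + k)) ^ n ≤ (u C n) ^ m * 2 ^ (2 * (n * n))) (+-comm 1 k)
    (m≤n≤u⇒[uCm]^n≤[uCn]^m*2^[2n²] (subst (_≤ n) (+-comm k 1) k+1≤n) n≤u)
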